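{- Let $\mathbb{V}\subseteq\mathbb{SDM}$ be a variety of semi-De Morgan algebras. The following are equivalent: (i) $\mathbb{V}$ is axiomatized by a finite set of equations; (ii) $\vdash^{\leq}_{\mathbb{V}}$ is axiomatized by a finite set of finitary (Hilbert) rule schemata.
   Context: Fix the language with binary connectives $\land,\lor$, unary $\neg$ and constants $\bot,\top$; $Fm$ is the set of formulas over a countably infinite set of variables. A distributive lattice with negation is an algebra $\langle A;\land,\lor,\neg,\bot,\top\rangle$ whose reduct $\langle A;\land,\lor,\bot,\top\rangle$ is a bounded distributive lattice and which satisfies $\neg\bot\approx\top$ and $\neg(x\lor y)\approx\neg x\land\neg y$. A semi-De Morgan algebra is a distributive lattice with negation satisfying moreover $\neg\top\approx\bot$, $\neg\neg(x\land y)\approx\neg\neg x\land\neg\neg y$ and $\neg x\approx\neg\neg\neg x$; $\mathbb{SDM}$ is the variety of semi-De Morgan algebras. For a class $\mathbb{K}$ of distributive lattices with negation, the order-preserving logic $\vdash^{\leq}_{\mathbb{K}}$ is given by: $\Gamma\vdash^{\leq}_{\mathbb{K}}\varphi$ iff for every $\mathbf{A}\in\mathbb{K}$, every non-empty lattice filter $F$ of $\mathbf{A}$ and every homomorphism $h\colon Fm\to A$, $h[\Gamma]\subseteq F$ implies $h(\varphi)\in F$. A finitary rule schema is a pair $\frac{\Gamma}{\varphi}$ with $\Gamma$ a finite (possibly empty) set of formulas; a set of rule schemata axiomatizes a logic if that logic coincides with derivability by Hilbert derivations using substitution instances of the rules. -}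

module Defs where

open import Data.Nat using (ℕ)
open import Data.Product using (_×_; _,_; Σ; ∃)
open import Data.List using (List; []; _∷_)
open import Data.List.Relation.Unary.All using (All)
open import Data.List.Membership.Propositional using (_∈_)
open import Relation.Binary.Structures using (IsEquivalence)
open import Function.Bundles using (_⇔_)
open import Level using (Level; suc; zero)

infixr 6 _⋀_
infixr 5 _⋁_
infix 7 ∼_

data Fm : Set where
  var  : ℕ → Fm
  _⋀_  : Fm → Fm → Fm
  _⋁_  : Fm → Fm → Fm
  ∼_   : Fm → Fm
  ⊥f   : Fm
  ⊤f   : Fm

subst : (ℕ → Fm) → Fm → Fm
subst σ (var n)  = σ n
subst σ (φ ⋀ ψ)  = subst σ φ ⋀ subst σ ψ
subst σ (φ ⋁ ψ)  = subst σ φ ⋁ subst σ ψ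
subst σ (∼ φ)    = ∼ subst σ φ
subst σ ⊥f       = ⊥f
subst σ ⊤f       = ⊤f

record Alg : Set₁ where
  field
    Carrier       : Set
    _≈_           : Carrier → Carrier → Set
    isEquivalence : IsEquivalence _≈_
    _∧_ _∨_       : Carrier → Carrier → Carrier
    ¬_            : Carrier → Carrier
    ⊥ ⊤           : Carrier
    ∧-cong : ∀ {a b c d} → a ≈ b → c ≈ d → (a ∧ c) ≈ (b ∧ d)
    ∨-cong : ∀ {a b c d} → a ≈ b → c ≈ d → (a ∨ c) ≈ (b ∨ d)
    ¬-cong : ∀ {a b} → a ≈ b → (¬ a) ≈ (¬ b)

module _ (A : Alg) where
  open Alg A

  ⟦_⟧ : Fm → (ℕ → Carrier) → Carrier
  ⟦ var n ⟧ v = v n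
  ⟦ φ ⋀ ψ ⟧ v = ⟦ φ ⟧ v ∧ ⟦ ψ ⟧ v
  ⟦ φ ⋁ ψ ⟧ v = ⟦ φ ⟧ v ∨ ⟦ ψ ⟧ v
  ⟦ ∼ φ ⟧ v   = ¬ ⟦ φ ⟧ v
  ⟦ ⊥f ⟧ v    = ⊥
  ⟦ ⊤f ⟧ v    = ⊤

Eqn : Set
Eqn = Fm × Fm

_⊨_ : Alg → Eqn → Set
A ⊨ (s , t) = ∀ (v : ℕ → Alg.Carrier A) → Alg._≈_ A (⟦ A ⟧ s v) (⟦ A ⟧ t v)

Mod : (Eqn → Set) → Alg → Set
Mod E A = ∀ e → E e → A ⊨ e

ModL : List Eqn → Alg → Set
ModL L A = All (A ⊨_) L

private
  x y z : Fm
  x = var 0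
  y = var 1
  z = var 2

SDM-axioms : List Eqn
SDM-axioms =
    (x ⋀ (y ⋀ z) , (x ⋀ y) ⋀ z)
  ∷ (x ⋁ (y ⋁ z) , (x ⋁ y) ⋁ z)
  ∷ (x ⋀ y , y ⋀ x)
  ∷ (x ⋁ y , y ⋁ x)
  ∷ (x ⋀ (x ⋁ y) , x)
  ∷ (x ⋁ (x ⋀ y) , x)
  ∷ (x ⋀ ⊤f , x)
  ∷ (x ⋁ ⊥f , x)
  ∷ (x ⋀ (y ⋁ z) , (x ⋀ y) ⋁ (x ⋀ z))
  ∷ (∼ ⊥f , ⊤f)
  ∷ (∼ (x ⋁ y) , ∼ x ⋀ ∼ y)
  ∷ (∼ ⊤f , ⊥f)
  ∷ (∼ ∼ (x ⋀ y) , ∼ ∼ x ⋀ ∼ ∼ y)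
  ∷ (∼ x , ∼ ∼ ∼ x)
  ∷ []

IsSDM : Alg → Set
IsSDM A = ModL SDM-axioms A

record IsFilter (A : Alg) (F : Alg.Carrier A → Set) : Set where
  open Alg A
  field
    nonempty : ∃ λ a → F a
    upward   : ∀ {a b} → F a → (a ∧ b) ≈ a → F b   -- a ≤ b
    meet     : ∀ {a b} → F a → F b → F (a ∧ b)

Logic : Set₂
Logic = (Fm → Set) → Fm → Set₁

⊢≤ : (Alg → Set) → Logic
⊢≤ K Γ φ =
  ∀ (A : Alg) → K A →
  ∀ (F : Alg.Carrier A → Set) → IsFilter A F →
  ∀ (v : ℕ → Alg.Carrier A) →
  (∀ ψ → Γ ψ → F (⟦ A ⟧ ψ v)) → F (⟦ A ⟧ φ v)

Rule : Set
Rule = List Fm × Fm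

data Derivable (R : List Rule) (Γ : Fm → Set) : Fm → Set where
  assume : ∀ {φ} → Γ φ → Derivable R Γ φ
  apply  : ∀ {Δ ψ} → (Δ , ψ) ∈ R → (σ : ℕ → Fm) →
           All (λ δ → Derivable R Γ (subst σ δ)) Δ →
           Derivable R Γ (subst σ ψ)

Axiomatizes : List Rule → Logic → Set₁
Axiomatizes R ⊢ = ∀ (Γ : Fm → Set) (φ : Fm) → ⊢ Γ φ ⇔ Derivable R Γ φ

FinitelyAxiomatizableLogic : Logic → Set₁
FinitelyAxiomatizableLogic ⊢ = Σ (List Rule) λ R → Axiomatizes R ⊢

FinitelyBasedVariety : (Eqn → Set) → Set₁
FinitelyBasedVariety E = Σ (List Eqn) λ L → ∀ (A : Alg) → ModL L A ⇔ Mod E A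

module Submission where

-- (ii) ⇒ (i). A rule Δ / ψ holds in the order-preserving logic of a class of semi-De Morgan
-- algebras iff the class satisfies ⋀Δ ≤ ψ (use the principal filter of ⋀Δ), and an
-- equation s ≈ t holds iff both s / t and t / s do. So if finitely many rules axiomatize
-- ⊢≤ of V, then V is axiomatized by the SDM axioms together with the finitely many
-- inequalities ⋀Δ ≤ ψ of these rules.
--
-- (i) ⇒ (ii). For a finite basis L take the lattice rules and, for every equation s ≈ t
-- of L or of a fixed finite list of SDM identities, in both directions, the rules
-- φ(s) / φ(t) for the four frames φ(x) = x, x ∨ z, ¬(x ∧ w) ∨ z, ¬(¬x ∧ w) ∨ z. The
-- identities move any context of a disjunct, step by step, into one of these frames, so
-- derivability is invariant under replacing subterms by L-provably equal ones. Hence the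
-- formulas derivable from Γ form a filter of the term algebra Fm / L, which lies in V;
-- evaluating the consequence Γ ⊢≤ φ there at the identity valuation gives completeness.

open import Defs
open import Algebra.Lattice.Bundles using (DistributiveLattice)
open import Algebra.Lattice.Structures.Biased using (isDistributiveLatticeʳʲᵐ)
import Algebra.Lattice.Properties.DistributiveLattice as DistributiveLatticeProperties
open import Data.Nat using (ℕ; zero; suc)
open import Data.Product using (_×_; _,_; proj₁; proj₂; swap)
open import Data.Unit using () renaming (⊤ to Unit)
open import Data.List using (List; []; _∷_; _++_; map; concatMap)
open import Data.List.Membership.Propositional.Properties using (∈-++⁺ˡ; ∈-++⁺ʳ; ∈-map⁺; ∈-concat⁺′)
open import Data.List.Relation.Unary.All as All using (All; []; _∷_)
import Data.List.Relation.Unary.All.Properties as All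
open import Data.List.Relation.Unary.Any using (here; there)
open import Data.List.Membership.Propositional using (_∈_)
open import Function using (_∘_)
open import Function.Bundles using (_⇔_; mk⇔; Equivalence)
open import Level using (0ℓ)
open import Relation.Binary.Bundles using (Setoid)
open import Relation.Binary.PropositionalEquality as ≡ using (_≡_; refl; cong; cong₂)
import Relation.Binary.Lattice as OrderTheoretic
import Relation.Binary.Reasoning.Setoid as SetoidReasoning
open import Relation.Binary.Structures using (IsEquivalence)

subst-∘ : ∀ (σ ρ : ℕ → Fm) φ → subst σ (subst ρ φ) ≡ subst (subst σ ∘ ρ) φ
subst-∘ σ ρ (var n) = refl
subst-∘ σ ρ (φ ⋀ ψ) = cong₂ _⋀_ (subst-∘ σ ρ φ) (subst-∘ σ ρ ψ)
subst-∘ σ ρ (φ ⋁ ψ) = cong₂ _⋁_ (subst-∘ σ ρ φ) (subst-∘ σ ρ ψ)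
subst-∘ σ ρ (∼ φ)   = cong ∼_ (subst-∘ σ ρ φ)
subst-∘ σ ρ ⊥f      = refl
subst-∘ σ ρ ⊤f      = refl

subst-var : ∀ φ → subst var φ ≡ φ
subst-var (var n) = refl
subst-var (φ ⋀ ψ) = cong₂ _⋀_ (subst-var φ) (subst-var ψ)
subst-var (φ ⋁ ψ) = cong₂ _⋁_ (subst-var φ) (subst-var ψ)
subst-var (∼ φ)   = cong ∼_ (subst-var φ)
subst-var ⊥f      = refl
subst-var ⊤f      = refl

⟦⟧-subst : ∀ (A : Alg) (σ : ℕ → Fm) v φ → ⟦ A ⟧ (subst σ φ) v ≡ ⟦ A ⟧ φ (λ n → ⟦ A ⟧ (σ n) v)
⟦⟧-subst A σ v (var n) = refl
⟦⟧-subst A σ v (φ ⋀ ψ) = cong₂ (Alg._∧_ A) (⟦⟧-subst A σ v φ) (⟦⟧-subst A σ v ψ)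
⟦⟧-subst A σ v (φ ⋁ ψ) = cong₂ (Alg._∨_ A) (⟦⟧-subst A σ v φ) (⟦⟧-subst A σ v ψ)
⟦⟧-subst A σ v (∼ φ)   = cong (Alg.¬_ A) (⟦⟧-subst A σ v φ)
⟦⟧-subst A σ v ⊥f      = refl
⟦⟧-subst A σ v ⊤f      = refl

record SDMLaws (A : Alg) : Set where
  open Alg A
  field
    ∧-assoc      : ∀ a b c → (a ∧ (b ∧ c)) ≈ ((a ∧ b) ∧ c)
    ∨-assoc      : ∀ a b c → (a ∨ (b ∨ c)) ≈ ((a ∨ b) ∨ c)
    ∧-comm       : ∀ a b → (a ∧ b) ≈ (b ∧ a)
    ∨-comm       : ∀ a b → (a ∨ b) ≈ (b ∨ a)
    ∧-absorbs-∨  : ∀ a b → (a ∧ (a ∨ b)) ≈ a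
    ∨-absorbs-∧  : ∀ a b → (a ∨ (a ∧ b)) ≈ a
    ∧-identityʳ  : ∀ a → (a ∧ ⊤) ≈ a
    ∨-identityʳ  : ∀ a → (a ∨ ⊥) ≈ a
    ∧-distribˡ-∨ : ∀ a b c → (a ∧ (b ∨ c)) ≈ ((a ∧ b) ∨ (a ∧ c))
    ¬-∨          : ∀ a b → (¬ (a ∨ b)) ≈ ((¬ a) ∧ (¬ b))
    ¬¬-∧         : ∀ a b → (¬ ¬ (a ∧ b)) ≈ ((¬ ¬ a) ∧ (¬ ¬ b))
    ¬≈¬¬¬        : ∀ a → (¬ a) ≈ (¬ ¬ ¬ a)

sdmLaws : ∀ A → IsSDM A → SDMLaws A
sdmLaws A (∧a ∷ ∨a ∷ ∧c ∷ ∨c ∷ ∧∨ ∷ ∨∧ ∷ ∧⊤ ∷ ∨⊥ ∷ ∧∨d ∷ _ ∷ ¬∨ ∷ _ ∷ ¬¬∧ ∷ ¬¬¬ ∷ []) = record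
  { ∧-assoc      = λ a b c → ∧a (env a b c)
  ; ∨-assoc      = λ a b c → ∨a (env a b c)
  ; ∧-comm       = λ a b → ∧c (env a b b)
  ; ∨-comm       = λ a b → ∨c (env a b b)
  ; ∧-absorbs-∨  = λ a b → ∧∨ (env a b b)
  ; ∨-absorbs-∧  = λ a b → ∨∧ (env a b b)
  ; ∧-identityʳ  = λ a → ∧⊤ (env a a a)
  ; ∨-identityʳ  = λ a → ∨⊥ (env a a a)
  ; ∧-distribˡ-∨ = λ a b c → ∧∨d (env a b c)
  ; ¬-∨          = λ a b → ¬∨ (env a b b)
  ; ¬¬-∧         = λ a b → ¬¬∧ (env a b b)
  ; ¬≈¬¬¬        = λ a → ¬¬¬ (env a a a)
  }
  where
  env : (a b c : Alg.Carrier A) → ℕ → Alg.Carrier A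
  env a b c 0 = a
  env a b c 1 = b
  env a b c _ = c

module SemiDeMorgan (A : Alg) (sdm : IsSDM A) where
  open Alg A public
  open SDMLaws (sdmLaws A sdm) public
  open IsEquivalence isEquivalence public using ()
    renaming (refl to ≈-refl; sym to ≈-sym; trans to ≈-trans)

  setoid : Setoid 0ℓ 0ℓ
  setoid = record { isEquivalence = isEquivalence }

  open SetoidReasoning setoid public

  -- The SDM axioms give distributivity of ∧ over ∨, which is the law the biased
  -- constructor asks for in the dual lattice ⟨A; ∧, ∨⟩.
  private
    ∧-distribʳ-∨ : ∀ a b c → ((b ∨ c) ∧ a) ≈ ((b ∧ a) ∨ (c ∧ a))
    ∧-distribʳ-∨ a b c = begin
      (b ∨ c) ∧ a          ≈⟨ ∧-comm (b ∨ c) a ⟩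
      a ∧ (b ∨ c)          ≈⟨ ∧-distribˡ-∨ a b c ⟩
      (a ∧ b) ∨ (a ∧ c)    ≈⟨ ∨-cong (∧-comm a b) (∧-comm a c) ⟩
      (b ∧ a) ∨ (c ∧ a)    ∎

    dualDistributiveLattice : DistributiveLattice 0ℓ 0ℓ
    dualDistributiveLattice = record
      { Carrier = Carrier
      ; _≈_ = _≈_
      ; _∨_ = _∧_
      ; _∧_ = _∨_
      ; isDistributiveLattice = isDistributiveLatticeʳʲᵐ (record
        { isLattice = record
          { isEquivalence = isEquivalence
          ; ∨-comm = ∧-comm
          ; ∨-assoc = λ a b c → ≈-sym (∧-assoc a b c)
          ; ∨-cong = ∧-cong
          ; ∧-comm = ∨-comm
          ; ∧-assoc = λ a b c → ≈-sym (∨-assoc a b c)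
          ; ∧-cong = ∨-cong
          ; absorptive = ∧-absorbs-∨ , ∨-absorbs-∧
          }
        ; ∨-distribʳ-∧ = ∧-distribʳ-∨
        })
      }

  distributiveLattice : DistributiveLattice 0ℓ 0ℓ
  distributiveLattice = record
    { isDistributiveLattice =
        DistributiveLatticeProperties.∧-∨-isDistributiveLattice dualDistributiveLattice
    }

  open DistributiveLattice distributiveLattice public using (∨-distribʳ-∧)
  open DistributiveLatticeProperties distributiveLattice public using (∨-∧-orderTheoreticLattice)
  open OrderTheoretic.Lattice ∨-∧-orderTheoreticLattice public
    using (_≤_; x∧y≤x; x∧y≤y; ∧-greatest)
    renaming (refl to ≤-refl; reflexive to ≤-reflexive; trans to ≤-trans; antisym to ≤-antisym)

  x≤⊤ : ∀ a → a ≤ ⊤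
  x≤⊤ a = ≈-sym (∧-identityʳ a)

  module _ {F : Carrier → Set} (isF : IsFilter A F) where
    open IsFilter isF

    filter-upward : ∀ {a b} → F a → a ≤ b → F b
    filter-upward Fa a≤b = upward Fa (≈-sym a≤b)

    filter-resp : ∀ {a b} → F a → a ≈ b → F b
    filter-resp Fa a≈b = filter-upward Fa (≤-reflexive a≈b)

    filter-⊤ : F ⊤
    filter-⊤ = filter-upward (proj₂ nonempty) (x≤⊤ _)

  ↑ : Carrier → Carrier → Set
  ↑ a = a ≤_

  ↑-isFilter : ∀ a → IsFilter A (↑ a)
  ↑-isFilter a = record
    { nonempty = a , ≤-refl
    ; upward = λ a≤b b∧c≈b → ≤-trans a≤b (≈-sym b∧c≈b)
    ; meet = ∧-greatest
    }

  ¬-∧-¬¬ : ∀ a b → (¬ (a ∧ b)) ≈ (¬ ((¬ ¬ a) ∧ (¬ ¬ b)))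
  ¬-∧-¬¬ a b = ≈-trans (¬≈¬¬¬ (a ∧ b)) (¬-cong (¬¬-∧ a b))

  ¬-absorbs-¬¬ : ∀ a b → (¬ ((¬ ¬ a) ∧ b)) ≈ (¬ (a ∧ b))
  ¬-absorbs-¬¬ a b = begin
    ¬ ((¬ ¬ a) ∧ b)                ≈⟨ ¬-∧-¬¬ (¬ ¬ a) b ⟩
    ¬ ((¬ ¬ ¬ ¬ a) ∧ (¬ ¬ b))      ≈⟨ ¬-cong (∧-cong (¬≈¬¬¬ (¬ a)) ≈-refl) ⟨
    ¬ ((¬ ¬ a) ∧ (¬ ¬ b))          ≈⟨ ¬-∧-¬¬ a b ⟨
    ¬ (a ∧ b)                      ∎

  ¬-distrib-∨∧ : ∀ a b c → (¬ ((a ∨ b) ∧ c)) ≈ ((¬ (a ∧ c)) ∧ (¬ (b ∧ c)))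
  ¬-distrib-∨∧ a b c = ≈-trans (¬-cong (∧-distribʳ-∨ c a b)) (¬-∨ (a ∧ c) (b ∧ c))

  ¬-distrib-¬∧∧ : ∀ a b c →
    (¬ ((¬ (a ∧ b)) ∧ c)) ≈ ((¬ ((¬ a) ∧ (¬ ¬ c))) ∧ (¬ ((¬ b) ∧ (¬ ¬ c))))
  ¬-distrib-¬∧∧ a b c = begin
    ¬ ((¬ (a ∧ b)) ∧ c)                              ≈⟨ ¬-∧-¬¬ _ c ⟩
    ¬ ((¬ ¬ ¬ (a ∧ b)) ∧ (¬ ¬ c))                    ≈⟨ ¬-cong (∧-cong (¬≈¬¬¬ (a ∧ b)) ≈-refl) ⟨
    ¬ ((¬ (a ∧ b)) ∧ (¬ ¬ c))                        ≈⟨ ¬-cong (¬-∨ (a ∧ b) (¬ c)) ⟨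
    ¬ ¬ ((a ∧ b) ∨ (¬ c))                            ≈⟨ ¬-cong (¬-cong (∨-distribʳ-∧ (¬ c) a b)) ⟩
    ¬ ¬ ((a ∨ (¬ c)) ∧ (b ∨ (¬ c)))                  ≈⟨ ¬¬-∧ _ _ ⟩
    (¬ ¬ (a ∨ (¬ c))) ∧ (¬ ¬ (b ∨ (¬ c)))            ≈⟨ ∧-cong (¬-cong (¬-∨ a (¬ c))) (¬-cong (¬-∨ b (¬ c))) ⟩
    (¬ ((¬ a) ∧ (¬ ¬ c))) ∧ (¬ ((¬ b) ∧ (¬ ¬ c)))    ∎

⋀⁺ : List Fm → Fm
⋀⁺ []      = ⊤f
⋀⁺ (δ ∷ Δ) = δ ⋀ ⋀⁺ Δ

ruleEqn : Rule → Eqn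
ruleEqn (Δ , ψ) = (⋀⁺ Δ ⋀ ψ , ⋀⁺ Δ)

rule-derivable : ∀ {R Δ ψ} → (Δ , ψ) ∈ R → Derivable R (_∈ Δ) ψ
rule-derivable {R} {Δ} {ψ} r∈R =
  ≡.subst (Derivable R _) (subst-var ψ) (apply r∈R var (All.tabulate premise))
  where
  premise : ∀ {δ} → δ ∈ Δ → Derivable R (_∈ Δ) (subst var δ)
  premise {δ} δ∈Δ = ≡.subst (Derivable R _) (≡.sym (subst-var δ)) (assume δ∈Δ)

module _ (A : Alg) (sdm : IsSDM A) where
  open SemiDeMorgan A sdm

  ⋀⁺-lowerBound : ∀ v {Δ δ} → δ ∈ Δ → ⟦ A ⟧ (⋀⁺ Δ) v ≤ ⟦ A ⟧ δ v
  ⋀⁺-lowerBound v (here refl)  = x∧y≤x _ _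
  ⋀⁺-lowerBound v (there δ∈Δ) = ≤-trans (x∧y≤y _ _) (⋀⁺-lowerBound v δ∈Δ)

  module _ {R : List Rule} (R-valid : ∀ {r} → r ∈ R → A ⊨ ruleEqn r)
           {F : Carrier → Set} (isF : IsFilter A F) (v : ℕ → Carrier)
           {Γ : Fm → Set} (Γ⊆F : ∀ ψ → Γ ψ → F (⟦ A ⟧ ψ v)) where

    derivable-sound : ∀ {φ} → Derivable R Γ φ → F (⟦ A ⟧ φ v)
    premises-sound : ∀ {Δ} σ → All (λ δ → Derivable R Γ (subst σ δ)) Δ →
                     F (⟦ A ⟧ (⋀⁺ Δ) (λ n → ⟦ A ⟧ (σ n) v))

    derivable-sound (assume γ) = Γ⊆F _ γ
    derivable-sound (apply {ψ = ψ} r∈R σ ds) =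
      ≡.subst F (≡.sym (⟦⟧-subst A σ v ψ))
        (IsFilter.upward isF (premises-sound σ ds) (R-valid r∈R (λ n → ⟦ A ⟧ (σ n) v)))

    premises-sound σ []             = filter-⊤ isF
    premises-sound σ (_∷_ {δ} d ds) =
      IsFilter.meet isF (≡.subst F (⟦⟧-subst A σ v δ) (derivable-sound d)) (premises-sound σ ds)

  derivable⇒≤ : ∀ {R} → (∀ {r} → r ∈ R → A ⊨ ruleEqn r) →
                ∀ {s t} → Derivable R (_≡ s) t → ∀ v → ⟦ A ⟧ s v ≤ ⟦ A ⟧ t v
  derivable⇒≤ R-valid {s} d v =
    derivable-sound R-valid (↑-isFilter (⟦ A ⟧ s v)) v (λ { _ refl → ≤-refl }) d

⊨-swap : ∀ A s t → A ⊨ (s , t) → A ⊨ (t , s)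
⊨-swap A s t s≈t v = IsEquivalence.sym (Alg.isEquivalence A) (s≈t v)

module _ {K : Alg → Set} (K⊆SDM : ∀ A → K A → IsSDM A) where

  valid-equation⇒⊢≤ : ∀ {s t} → (∀ A → K A → A ⊨ (s , t)) → ⊢≤ K (_≡ s) t
  valid-equation⇒⊢≤ {s} s≈t A KA F isF v s∈F = filter-resp isF (s∈F s refl) (s≈t A KA v)
    where open SemiDeMorgan A (K⊆SDM A KA)

  ⊢≤⇒valid-rule : ∀ {Δ ψ} → ⊢≤ K (_∈ Δ) ψ → ∀ A → K A → A ⊨ ruleEqn (Δ , ψ)
  ⊢≤⇒valid-rule {Δ} Δ⊢ψ A KA v =
    ≈-sym (Δ⊢ψ A KA (↑ (⟦ A ⟧ (⋀⁺ Δ) v)) (↑-isFilter _) v (λ _ → ⋀⁺-lowerBound A sdm v))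
    where
    sdm : IsSDM A
    sdm = K⊆SDM A KA
    open SemiDeMorgan A sdm

finitelyBased : ∀ {E} → (∀ A → Mod E A → IsSDM A) →
                FinitelyAxiomatizableLogic (⊢≤ (Mod E)) → FinitelyBasedVariety E
finitelyBased {E} E⊆SDM (R , R-axiomatizes) =
  SDM-axioms ++ map ruleEqn R , λ A → mk⇔ (base⇒E A) (E⇒base A)
  where
  base⇒E : ∀ A → ModL (SDM-axioms ++ map ruleEqn R) A → Mod E A
  base⇒E A ⊨base (s , t) st∈E v = ≤-antisym (valid⇒≤ {s} {t} (λ B ⊨E → ⊨E _ st∈E))
                                           (valid⇒≤ {t} {s} (λ B ⊨E → ⊨-swap B s t (⊨E _ st∈E)))
    where
    sdm : IsSDM A
    sdm = All.++⁻ˡ SDM-axioms ⊨base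
    open SemiDeMorgan A sdm
    valid⇒≤ : ∀ {a b} → (∀ B → Mod E B → B ⊨ (a , b)) → ⟦ A ⟧ a v ≤ ⟦ A ⟧ b v
    valid⇒≤ {a} {b} a≈b = derivable⇒≤ A sdm (All.lookup (All.map⁻ (All.++⁻ʳ SDM-axioms ⊨base)))
      (Equivalence.to (R-axiomatizes _ b) (valid-equation⇒⊢≤ E⊆SDM {a} {b} a≈b)) v

  E⇒base : ∀ A → Mod E A → ModL (SDM-axioms ++ map ruleEqn R) A
  E⇒base A ⊨E = All.++⁺ (E⊆SDM A ⊨E) (All.map⁺ (All.tabulate λ { {Δ , ψ} r∈R →
    ⊢≤⇒valid-rule E⊆SDM {Δ} {ψ} (Equivalence.from (R-axiomatizes (_∈ Δ) ψ) (rule-derivable r∈R)) A ⊨E }))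

X Y Z : Fm
X = var 0
Y = var 1
Z = var 2

data Identity : Set where
  x∨⊥ [x∨y]∨z [y∨x]∨z [x∧y]∨z [y∧x]∨z ¬x ¬[[x∧y]∧z] ¬[[y∧x]∧z] ¬[[x∨y]∧z] ¬[[y∨x]∧z]
    ¬[¬¬x∧y] ¬[¬[x∨y]∧z] ¬[¬[y∨x]∧z] ¬[¬[x∧y]∧z] ¬[¬[y∧x]∧z] : Identity

identity : Identity → Eqn
identity x∨⊥         = (X ⋁ ⊥f , X)
identity [x∨y]∨z     = ((X ⋁ Y) ⋁ Z , X ⋁ (Y ⋁ Z))
identity [y∨x]∨z     = ((Y ⋁ X) ⋁ Z , X ⋁ (Y ⋁ Z))
identity [x∧y]∨z     = ((X ⋀ Y) ⋁ Z , (X ⋁ Z) ⋀ (Y ⋁ Z))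
identity [y∧x]∨z     = ((Y ⋀ X) ⋁ Z , (X ⋁ Z) ⋀ (Y ⋁ Z))
identity ¬x          = (∼ X , ∼ (X ⋀ ⊤f))
identity ¬[[x∧y]∧z]  = (∼ ((X ⋀ Y) ⋀ Z) , ∼ (X ⋀ (Y ⋀ Z)))
identity ¬[[y∧x]∧z]  = (∼ ((Y ⋀ X) ⋀ Z) , ∼ (X ⋀ (Y ⋀ Z)))
identity ¬[[x∨y]∧z]  = (∼ ((X ⋁ Y) ⋀ Z) , ∼ (X ⋀ Z) ⋀ ∼ (Y ⋀ Z))
identity ¬[[y∨x]∧z]  = (∼ ((Y ⋁ X) ⋀ Z) , ∼ (X ⋀ Z) ⋀ ∼ (Y ⋀ Z))
identity ¬[¬¬x∧y]    = (∼ (∼ ∼ X ⋀ Y) , ∼ (X ⋀ Y))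
identity ¬[¬[x∨y]∧z] = (∼ (∼ (X ⋁ Y) ⋀ Z) , ∼ (∼ X ⋀ (∼ Y ⋀ Z)))
identity ¬[¬[y∨x]∧z] = (∼ (∼ (Y ⋁ X) ⋀ Z) , ∼ (∼ X ⋀ (∼ Y ⋀ Z)))
identity ¬[¬[x∧y]∧z] = (∼ (∼ (X ⋀ Y) ⋀ Z) , ∼ (∼ X ⋀ ∼ ∼ Z) ⋀ ∼ (∼ Y ⋀ ∼ ∼ Z))
identity ¬[¬[y∧x]∧z] = (∼ (∼ (Y ⋀ X) ⋀ Z) , ∼ (∼ X ⋀ ∼ ∼ Z) ⋀ ∼ (∼ Y ⋀ ∼ ∼ Z))

identities : List Identity
identities =
  x∨⊥ ∷ [x∨y]∨z ∷ [y∨x]∨z ∷ [x∧y]∨z ∷ [y∧x]∨z ∷ ¬x ∷ ¬[[x∧y]∧z] ∷ ¬[[y∧x]∧z] ∷ ¬[[x∨y]∧z] ∷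
  ¬[[y∨x]∧z] ∷ ¬[¬¬x∧y] ∷ ¬[¬[x∨y]∧z] ∷ ¬[¬[y∨x]∧z] ∷ ¬[¬[x∧y]∧z] ∷ ¬[¬[y∧x]∧z] ∷ []

∈-identities : ∀ i → i ∈ identities
∈-identities x∨⊥         = here refl
∈-identities [x∨y]∨z     = there (here refl)
∈-identities [y∨x]∨z     = there (there (here refl))
∈-identities [x∧y]∨z     = there (there (there (here refl)))
∈-identities [y∧x]∨z     = there (there (there (there (here refl))))
∈-identities ¬x          = there (there (there (there (there (here refl)))))
∈-identities ¬[[x∧y]∧z]  = there (there (there (there (there (there (here refl))))))
∈-identities ¬[[y∧x]∧z]  = there (there (there (there (there (there (there (here refl)))))))
∈-identities ¬[[x∨y]∧z]  = there (there (there (there (there (there (there (there (here refl))))))))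
∈-identities ¬[[y∨x]∧z]  = there (there (there (there (there (there (there (there (there (here refl)))))))))
∈-identities ¬[¬¬x∧y]    = there (there (there (there (there (there (there (there (there (there (here refl))))))))))
∈-identities ¬[¬[x∨y]∧z] = there (there (there (there (there (there (there (there (there (there (there (here refl)))))))))))
∈-identities ¬[¬[y∨x]∧z] = there (there (there (there (there (there (there (there (there (there (there (there (here refl))))))))))))
∈-identities ¬[¬[x∧y]∧z] = there (there (there (there (there (there (there (there (there (there (there (there (there (here refl)))))))))))))
∈-identities ¬[¬[y∧x]∧z] = there (there (there (there (there (there (there (there (there (there (there (there (there (there (here refl))))))))))))))

identity-sound : ∀ A → IsSDM A → ∀ i → A ⊨ identity i
identity-sound A sdm = sound
  where
  open SemiDeMorgan A sdm
  sound : ∀ i → A ⊨ identity i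
  sound x∨⊥         v = ∨-identityʳ _
  sound [x∨y]∨z     v = ≈-sym (∨-assoc _ _ _)
  sound [y∨x]∨z     v = ≈-trans (∨-cong (∨-comm _ _) ≈-refl) (sound [x∨y]∨z v)
  sound [x∧y]∨z     v = ∨-distribʳ-∧ _ _ _
  sound [y∧x]∨z     v = ≈-trans (∨-cong (∧-comm _ _) ≈-refl) (sound [x∧y]∨z v)
  sound ¬x          v = ¬-cong (≈-sym (∧-identityʳ _))
  sound ¬[[x∧y]∧z]  v = ¬-cong (≈-sym (∧-assoc _ _ _))
  sound ¬[[y∧x]∧z]  v = ≈-trans (¬-cong (∧-cong (∧-comm _ _) ≈-refl)) (sound ¬[[x∧y]∧z] v)
  sound ¬[[x∨y]∧z]  v = ¬-distrib-∨∧ _ _ _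
  sound ¬[[y∨x]∧z]  v = ≈-trans (¬-cong (∧-cong (∨-comm _ _) ≈-refl)) (sound ¬[[x∨y]∧z] v)
  sound ¬[¬¬x∧y]    v = ¬-absorbs-¬¬ _ _
  sound ¬[¬[x∨y]∧z] v = ¬-cong (≈-trans (∧-cong (¬-∨ _ _) ≈-refl) (≈-sym (∧-assoc _ _ _)))
  sound ¬[¬[y∨x]∧z] v = ≈-trans (¬-cong (∧-cong (¬-cong (∨-comm _ _)) ≈-refl)) (sound ¬[¬[x∨y]∧z] v)
  sound ¬[¬[x∧y]∧z] v = ¬-distrib-¬∧∧ _ _ _
  sound ¬[¬[y∧x]∧z] v = ≈-trans (¬-cong (∧-cong (¬-cong (∧-comm _ _)) ≈-refl)) (sound ¬[¬[x∧y]∧z] v)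

-- The number of variables of an identity, so that its instantiation can be inferred
-- from the formulas it rewrites.
arity : Identity → ℕ
arity x∨⊥      = 1
arity ¬x       = 1
arity ¬[¬¬x∧y] = 2
arity _        = 3

Fmⁿ : ℕ → Set
Fmⁿ zero    = Unit
Fmⁿ (suc n) = Fm × Fmⁿ n

⟪_⟫ : ∀ {n} → Fmⁿ n → ℕ → Fm
⟪_⟫ {zero}  _        k       = var k
⟪_⟫ {suc n} (a , as) zero    = a
⟪_⟫ {suc n} (a , as) (suc k) = ⟪ as ⟫ k

data Frame : Set where
  ∙ ∙∨z ¬[∙∧w]∨z ¬[¬∙∧w]∨z : Frame

fill : Frame → Fm → Fm → Fm → Fm
fill ∙         h w z = h
fill ∙∨z       h w z = h ⋁ z
fill ¬[∙∧w]∨z  h w z = ∼ (h ⋀ w) ⋁ z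
fill ¬[¬∙∧w]∨z h w z = ∼ (∼ h ⋀ w) ⋁ z

fill-subst : ∀ ρ k h → subst ρ (fill k h (var 0) (var 1)) ≡ fill k (subst ρ h) (ρ 0) (ρ 1)
fill-subst ρ ∙         h = refl
fill-subst ρ ∙∨z       h = refl
fill-subst ρ ¬[∙∧w]∨z  h = refl
fill-subst ρ ¬[¬∙∧w]∨z h = refl

module _ (A : Alg) where
  open Alg A
  open IsEquivalence isEquivalence using () renaming (refl to ≈-refl)

  fill-cong : ∀ k {a b} v → ⟦ A ⟧ a v ≈ ⟦ A ⟧ b v →
              ⟦ A ⟧ (fill k a (var 0) (var 1)) v ≈ ⟦ A ⟧ (fill k b (var 0) (var 1)) v
  fill-cong ∙         v a≈b = a≈b
  fill-cong ∙∨z       v a≈b = ∨-cong a≈b ≈-refl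
  fill-cong ¬[∙∧w]∨z  v a≈b = ∨-cong (¬-cong (∧-cong a≈b ≈-refl)) ≈-refl
  fill-cong ¬[¬∙∧w]∨z v a≈b = ∨-cong (¬-cong (∧-cong (¬-cong a≈b) ≈-refl)) ≈-refl

shift₂ : Fm → Fm
shift₂ = subst (var ∘ suc ∘ suc)

frameRule : Frame → Eqn → Rule
frameRule k (s , t) = (fill k (shift₂ s) (var 0) (var 1) ∷ [] , fill k (shift₂ t) (var 0) (var 1))

frameRules : Eqn → List Rule
frameRules e = map (λ k → frameRule k e) (∙ ∷ ∙∨z ∷ ¬[∙∧w]∨z ∷ ¬[¬∙∧w]∨z ∷ [])

∈-frameRules : ∀ k e → frameRule k e ∈ frameRules e
∈-frameRules ∙         e = here refl
∈-frameRules ∙∨z       e = there (here refl)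
∈-frameRules ¬[∙∧w]∨z  e = there (there (here refl))
∈-frameRules ¬[¬∙∧w]∨z e = there (there (there (here refl)))

extend : Fm → Fm → (ℕ → Fm) → ℕ → Fm
extend w z σ zero          = w
extend w z σ (suc zero)    = z
extend w z σ (suc (suc n)) = σ n

frameRule-instance : ∀ k σ w z h →
  subst (extend w z σ) (fill k (shift₂ h) (var 0) (var 1)) ≡ fill k (subst σ h) w z
frameRule-instance k σ w z h =
  ≡.trans (fill-subst (extend w z σ) k (shift₂ h))
          (cong (λ h′ → fill k h′ w z) (subst-∘ (extend w z σ) (var ∘ suc ∘ suc) h))

latticeRules : List Rule
latticeRules = ([] , ⊤f) ∷ (X ⋀ Y ∷ [] , X) ∷ (X ⋀ Y ∷ [] , Y) ∷ (X ∷ Y ∷ [] , X ⋀ Y) ∷ []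

module _ (A : Alg) (sdm : IsSDM A) where
  open SemiDeMorgan A sdm

  latticeRules-valid : All (λ r → A ⊨ ruleEqn r) latticeRules
  latticeRules-valid =
      (λ v → ≈-sym ≤-refl)
    ∷ (λ v → ≈-sym (≤-trans (x∧y≤x _ _) (x∧y≤x _ _)))
    ∷ (λ v → ≈-sym (≤-trans (x∧y≤x _ _) (x∧y≤y _ _)))
    ∷ (λ v → ≈-sym (∧-greatest (x∧y≤x _ _) (≤-trans (x∧y≤y _ _) (x∧y≤x _ _))))
    ∷ []

  frameRule-valid : ∀ k {e} → A ⊨ e → A ⊨ ruleEqn (frameRule k e)
  frameRule-valid k {s , t} s≈t v =
    ≈-sym (≤-trans (x∧y≤x _ _) (≤-reflexive (fill-cong A k v shifted)))
    where
    shifted : ⟦ A ⟧ (shift₂ s) v ≈ ⟦ A ⟧ (shift₂ t) v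
    shifted rewrite ⟦⟧-subst A (var ∘ suc ∘ suc) v s | ⟦⟧-subst A (var ∘ suc ∘ suc) v t =
      s≈t (v ∘ suc ∘ suc)

infixl 8 _[_]

data Ctx : Set where
  □    : Ctx
  _⋀ₗ_ : Ctx → Fm → Ctx
  _⋀ᵣ_ : Fm → Ctx → Ctx
  _⋁ₗ_ : Ctx → Fm → Ctx
  _⋁ᵣ_ : Fm → Ctx → Ctx
  ∼ᶜ_  : Ctx → Ctx

_[_] : Ctx → Fm → Fm
□        [ a ] = a
(C ⋀ₗ c) [ a ] = C [ a ] ⋀ c
(c ⋀ᵣ C) [ a ] = c ⋀ C [ a ]
(C ⋁ₗ c) [ a ] = C [ a ] ⋁ c
(c ⋁ᵣ C) [ a ] = c ⋁ C [ a ]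
(∼ᶜ C)   [ a ] = ∼ C [ a ]

_∘ᶜ_ : Ctx → Ctx → Ctx
□        ∘ᶜ D = D
(C ⋀ₗ c) ∘ᶜ D = (C ∘ᶜ D) ⋀ₗ c
(c ⋀ᵣ C) ∘ᶜ D = c ⋀ᵣ (C ∘ᶜ D)
(C ⋁ₗ c) ∘ᶜ D = (C ∘ᶜ D) ⋁ₗ c
(c ⋁ᵣ C) ∘ᶜ D = c ⋁ᵣ (C ∘ᶜ D)
(∼ᶜ C)   ∘ᶜ D = ∼ᶜ (C ∘ᶜ D)

[]-∘ᶜ : ∀ C D a → (C ∘ᶜ D) [ a ] ≡ C [ D [ a ] ]
[]-∘ᶜ □        D a = refl
[]-∘ᶜ (C ⋀ₗ c) D a = cong (_⋀ c) ([]-∘ᶜ C D a)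
[]-∘ᶜ (c ⋀ᵣ C) D a = cong (c ⋀_) ([]-∘ᶜ C D a)
[]-∘ᶜ (C ⋁ₗ c) D a = cong (_⋁ c) ([]-∘ᶜ C D a)
[]-∘ᶜ (c ⋁ᵣ C) D a = cong (c ⋁_) ([]-∘ᶜ C D a)
[]-∘ᶜ (∼ᶜ C)   D a = cong ∼_ ([]-∘ᶜ C D a)

infix 4 _⊢ₑ_≈_

data _⊢ₑ_≈_ (L : List Eqn) : Fm → Fm → Set where
  axiom  : ∀ {s t} → (s , t) ∈ L → ∀ σ → L ⊢ₑ subst σ s ≈ subst σ t
  refl   : ∀ {a} → L ⊢ₑ a ≈ a
  sym    : ∀ {a b} → L ⊢ₑ a ≈ b → L ⊢ₑ b ≈ a
  trans  : ∀ {a b c} → L ⊢ₑ a ≈ b → L ⊢ₑ b ≈ c → L ⊢ₑ a ≈ c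
  ⋀-cong : ∀ {a b c d} → L ⊢ₑ a ≈ b → L ⊢ₑ c ≈ d → L ⊢ₑ a ⋀ c ≈ b ⋀ d
  ⋁-cong : ∀ {a b c d} → L ⊢ₑ a ≈ b → L ⊢ₑ c ≈ d → L ⊢ₑ a ⋁ c ≈ b ⋁ d
  ∼-cong : ∀ {a b} → L ⊢ₑ a ≈ b → L ⊢ₑ ∼ a ≈ ∼ b

termAlgebra : List Eqn → Alg
termAlgebra L = record
  { Carrier       = Fm
  ; _≈_           = L ⊢ₑ_≈_
  ; isEquivalence = record { refl = refl ; sym = sym ; trans = trans }
  ; _∧_           = _⋀_
  ; _∨_           = _⋁_
  ; ¬_            = ∼_
  ; ⊥             = ⊥f
  ; ⊤             = ⊤f
  ; ∧-cong        = ⋀-cong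
  ; ∨-cong        = ⋁-cong
  ; ¬-cong        = ∼-cong
  }

⟦⟧-termAlgebra : ∀ L φ v → ⟦ termAlgebra L ⟧ φ v ≡ subst v φ
⟦⟧-termAlgebra L (var n) v = refl
⟦⟧-termAlgebra L (φ ⋀ ψ) v = cong₂ _⋀_ (⟦⟧-termAlgebra L φ v) (⟦⟧-termAlgebra L ψ v)
⟦⟧-termAlgebra L (φ ⋁ ψ) v = cong₂ _⋁_ (⟦⟧-termAlgebra L φ v) (⟦⟧-termAlgebra L ψ v)
⟦⟧-termAlgebra L (∼ φ)   v = cong ∼_ (⟦⟧-termAlgebra L φ v)
⟦⟧-termAlgebra L ⊥f      v = refl
⟦⟧-termAlgebra L ⊤f      v = refl

⟦⟧-termAlgebra-var : ∀ L φ → ⟦ termAlgebra L ⟧ φ var ≡ φ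
⟦⟧-termAlgebra-var L φ = ≡.trans (⟦⟧-termAlgebra L φ var) (subst-var φ)

termAlgebra-⊨ : ∀ L → ModL L (termAlgebra L)
termAlgebra-⊨ L = All.tabulate λ { {s , t} st∈L v →
  ≡.subst₂ (L ⊢ₑ_≈_) (≡.sym (⟦⟧-termAlgebra L s v)) (≡.sym (⟦⟧-termAlgebra L t v)) (axiom st∈L v) }

module FromBasis (L : List Eqn) where

  equations : List Eqn
  equations = L ++ map identity identities

  rewrites : List Eqn
  rewrites = equations ++ map swap equations

  rules : List Rule
  rules = latticeRules ++ concatMap frameRules rewrites

  basis-rewrite : ∀ {e} → e ∈ L → e ∈ rewrites
  basis-rewrite e∈L = ∈-++⁺ˡ (∈-++⁺ˡ e∈L)

  basis-rewrite˘ : ∀ {e} → e ∈ L → swap e ∈ rewrites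
  basis-rewrite˘ e∈L = ∈-++⁺ʳ equations (∈-map⁺ swap (∈-++⁺ˡ e∈L))

  identity-rewrite : ∀ i → identity i ∈ rewrites
  identity-rewrite i = ∈-++⁺ˡ (∈-++⁺ʳ L (∈-map⁺ identity (∈-identities i)))

  identity-rewrite˘ : ∀ i → swap (identity i) ∈ rewrites
  identity-rewrite˘ i = ∈-++⁺ʳ equations (∈-map⁺ swap (∈-++⁺ʳ L (∈-map⁺ identity (∈-identities i))))

  rules-valid : ∀ A → IsSDM A → ModL L A → ∀ {r} → r ∈ rules → A ⊨ ruleEqn r
  rules-valid A sdm ⊨L = All.lookup (All.++⁺ (latticeRules-valid A sdm)
                                             (All.concat⁺ (All.map⁺ {xs = rewrites} (All.map (λ {e} → frameRules-valid {e}) ⊨rewrites))))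
    where
    ⊨equations : All (A ⊨_) equations
    ⊨equations = All.++⁺ ⊨L (All.map⁺ {xs = identities} {f = identity} (All.tabulate λ {i} _ → identity-sound A sdm i))

    ⊨rewrites : All (A ⊨_) rewrites
    ⊨rewrites = All.++⁺ ⊨equations (All.map⁺ {xs = equations} {f = swap} (All.map (λ {e} → ⊨-swap A (proj₁ e) (proj₂ e)) ⊨equations))

    frameRules-valid : ∀ {e} → A ⊨ e → All (λ r → A ⊨ ruleEqn r) (frameRules e)
    frameRules-valid {e} ⊨e = valid ∙ ∷ valid ∙∨z ∷ valid ¬[∙∧w]∨z ∷ valid ¬[¬∙∧w]∨z ∷ []
      where
      valid : ∀ k → A ⊨ ruleEqn (frameRule k e)
      valid k = frameRule-valid A sdm k {e} ⊨e

  infix 4 _↝_ _↝ᶜ_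
  infixr 5 _▸_

  _↝_ : Fm → Fm → Set₁
  a ↝ b = ∀ {Γ} → Derivable rules Γ a → Derivable rules Γ b

  _▸_ : ∀ {a b c} → a ↝ b → b ↝ c → a ↝ c
  (p ▸ q) d = q (p d)

  ⊤-derivable : ∀ {Γ} → Derivable rules Γ ⊤f
  ⊤-derivable = apply (here refl) var []

  ∧-elimˡ : ∀ {a b} → a ⋀ b ↝ a
  ∧-elimˡ {a} {b} d = apply (there (here refl)) (⟪_⟫ {2} (a , b , _)) (d ∷ [])

  ∧-elimʳ : ∀ {a b} → a ⋀ b ↝ b
  ∧-elimʳ {a} {b} d = apply (there (there (here refl))) (⟪_⟫ {2} (a , b , _)) (d ∷ [])

  ∧-intro : ∀ {Γ a b} → Derivable rules Γ a → Derivable rules Γ b → Derivable rules Γ (a ⋀ b)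
  ∧-intro {a = a} {b} d e = apply (there (there (there (here refl)))) (⟪_⟫ {2} (a , b , _)) (d ∷ e ∷ [])

  ∧-mono : ∀ {a a′ b} → a ↝ a′ → a ⋀ b ↝ a′ ⋀ b
  ∧-mono p d = ∧-intro (p (∧-elimˡ d)) (∧-elimʳ d)

  rewrite-inFrame : ∀ {s t} → (s , t) ∈ rewrites → ∀ k σ w z →
               fill k (subst σ s) w z ↝ fill k (subst σ t) w z
  rewrite-inFrame {s} {t} st∈ k σ w z d =
    ≡.subst (Derivable rules _) (frameRule-instance k σ w z t)
      (apply (∈-++⁺ʳ latticeRules (∈-concat⁺′ (∈-frameRules k (s , t)) (∈-map⁺ frameRules st∈)))
             (extend w z σ)
             (≡.subst (Derivable rules _) (≡.sym (frameRule-instance k σ w z s)) d ∷ []))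

  -- ⊥f fills the frame variables that ∙ and ∙∨z do not mention.
  rewrite-top : ∀ {s t} → (s , t) ∈ rewrites → ∀ σ → subst σ s ↝ subst σ t
  rewrite-top st∈ σ = rewrite-inFrame st∈ ∙ σ ⊥f ⊥f

  rewrite-∨ : ∀ {s t} → (s , t) ∈ rewrites → ∀ σ z → subst σ s ⋁ z ↝ subst σ t ⋁ z
  rewrite-∨ st∈ σ z = rewrite-inFrame st∈ ∙∨z σ ⊥f z

  lhs rhs : ∀ i → Fmⁿ (arity i) → Fm
  lhs i as = subst (⟪_⟫ {arity i} as) (proj₁ (identity i))
  rhs i as = subst (⟪_⟫ {arity i} as) (proj₂ (identity i))

  fwd : ∀ i {as} → lhs i as ↝ rhs i as
  fwd i {as} = rewrite-top (identity-rewrite i) (⟪_⟫ {arity i} as)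

  bwd : ∀ i {as} → rhs i as ↝ lhs i as
  bwd i {as} = rewrite-top (identity-rewrite˘ i) (⟪_⟫ {arity i} as)

  fwd∨ : ∀ i {as z} → lhs i as ⋁ z ↝ rhs i as ⋁ z
  fwd∨ i {as} = rewrite-∨ (identity-rewrite i) (⟪_⟫ {arity i} as) _

  bwd∨ : ∀ i {as z} → rhs i as ⋁ z ↝ lhs i as ⋁ z
  bwd∨ i {as} = rewrite-∨ (identity-rewrite˘ i) (⟪_⟫ {arity i} as) _

  ∨-∧-mono : ∀ {a a′ b z} → a ⋁ z ↝ a′ ⋁ z → (a ⋀ b) ⋁ z ↝ (a′ ⋀ b) ⋁ z
  ∨-∧-mono p = fwd [x∧y]∨z ▸ ∧-mono p ▸ bwd [x∧y]∨z

  module Replacement {u v : Fm}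
    (∨-step   : ∀ z → u ⋁ z ↝ v ⋁ z)
    (¬∧-step  : ∀ w z → ∼ (u ⋀ w) ⋁ z ↝ ∼ (v ⋀ w) ⋁ z)
    (¬¬∧-step : ∀ w z → ∼ (∼ u ⋀ w) ⋁ z ↝ ∼ (∼ v ⋀ w) ⋁ z) where

    under-∨   : ∀ C z → C [ u ] ⋁ z ↝ C [ v ] ⋁ z
    under-¬∧  : ∀ C w z → ∼ (C [ u ] ⋀ w) ⋁ z ↝ ∼ (C [ v ] ⋀ w) ⋁ z
    under-¬¬∧ : ∀ C w z → ∼ (∼ C [ u ] ⋀ w) ⋁ z ↝ ∼ (∼ C [ v ] ⋀ w) ⋁ z

    under-∨ □        z = ∨-step z
    under-∨ (C ⋀ₗ c) z = ∨-∧-mono (under-∨ C z)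
    under-∨ (c ⋀ᵣ C) z = fwd [y∧x]∨z ▸ ∧-mono (under-∨ C z) ▸ bwd [y∧x]∨z
    under-∨ (C ⋁ₗ c) z = fwd [x∨y]∨z ▸ under-∨ C (c ⋁ z) ▸ bwd [x∨y]∨z
    under-∨ (c ⋁ᵣ C) z = fwd [y∨x]∨z ▸ under-∨ C (c ⋁ z) ▸ bwd [y∨x]∨z
    under-∨ (∼ᶜ C)   z = fwd∨ ¬x ▸ under-¬∧ C ⊤f z ▸ bwd∨ ¬x

    under-¬∧ □        w z = ¬∧-step w z
    under-¬∧ (C ⋀ₗ c) w z = fwd∨ ¬[[x∧y]∧z] ▸ under-¬∧ C (c ⋀ w) z ▸ bwd∨ ¬[[x∧y]∧z]
    under-¬∧ (c ⋀ᵣ C) w z = fwd∨ ¬[[y∧x]∧z] ▸ under-¬∧ C (c ⋀ w) z ▸ bwd∨ ¬[[y∧x]∧z]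
    under-¬∧ (C ⋁ₗ c) w z = fwd∨ ¬[[x∨y]∧z] ▸ ∨-∧-mono (under-¬∧ C w z) ▸ bwd∨ ¬[[x∨y]∧z]
    under-¬∧ (c ⋁ᵣ C) w z = fwd∨ ¬[[y∨x]∧z] ▸ ∨-∧-mono (under-¬∧ C w z) ▸ bwd∨ ¬[[y∨x]∧z]
    under-¬∧ (∼ᶜ C)   w z = under-¬¬∧ C w z

    under-¬¬∧ □        w z = ¬¬∧-step w z
    under-¬¬∧ (C ⋀ₗ c) w z = fwd∨ ¬[¬[x∧y]∧z] ▸ ∨-∧-mono (under-¬¬∧ C (∼ ∼ w) z) ▸ bwd∨ ¬[¬[x∧y]∧z]
    under-¬¬∧ (c ⋀ᵣ C) w z = fwd∨ ¬[¬[y∧x]∧z] ▸ ∨-∧-mono (under-¬¬∧ C (∼ ∼ w) z) ▸ bwd∨ ¬[¬[y∧x]∧z]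
    under-¬¬∧ (C ⋁ₗ c) w z = fwd∨ ¬[¬[x∨y]∧z] ▸ under-¬¬∧ C (∼ c ⋀ w) z ▸ bwd∨ ¬[¬[x∨y]∧z]
    under-¬¬∧ (c ⋁ᵣ C) w z = fwd∨ ¬[¬[y∨x]∧z] ▸ under-¬¬∧ C (∼ c ⋀ w) z ▸ bwd∨ ¬[¬[y∨x]∧z]
    under-¬¬∧ (∼ᶜ C)   w z = fwd∨ ¬[¬¬x∧y] ▸ under-¬∧ C w z ▸ bwd∨ ¬[¬¬x∧y]

  _↝ᶜ_ : Fm → Fm → Set₁
  a ↝ᶜ b = ∀ C z → C [ a ] ⋁ z ↝ C [ b ] ⋁ z

  ↝ᶜ-trans : ∀ {a b c} → a ↝ᶜ b → b ↝ᶜ c → a ↝ᶜ c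
  ↝ᶜ-trans p q C z = p C z ▸ q C z

  ↝ᶜ-inContext : ∀ {a b} → a ↝ᶜ b → ∀ D → D [ a ] ↝ᶜ D [ b ]
  ↝ᶜ-inContext {a} {b} p D C z =
    ≡.subst₂ _↝_ (cong (_⋁ z) ([]-∘ᶜ C D a)) (cong (_⋁ z) ([]-∘ᶜ C D b)) (p (C ∘ᶜ D) z)

  rewrite-↝ᶜ : ∀ {s t} → (s , t) ∈ rewrites → ∀ σ → subst σ s ↝ᶜ subst σ t
  rewrite-↝ᶜ st∈ σ = Replacement.under-∨ (rewrite-∨ st∈ σ) (rewrite-inFrame st∈ ¬[∙∧w]∨z σ)
                                         (rewrite-inFrame st∈ ¬[¬∙∧w]∨z σ)

  ⊢ₑ⇒↝ᶜ : ∀ {a b} → L ⊢ₑ a ≈ b → a ↝ᶜ b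
  ⊢ₑ⇒↜ᶜ : ∀ {a b} → L ⊢ₑ a ≈ b → b ↝ᶜ a

  ⊢ₑ⇒↝ᶜ (axiom st∈L σ) = rewrite-↝ᶜ (basis-rewrite st∈L) σ
  ⊢ₑ⇒↝ᶜ refl            = λ C z d → d
  ⊢ₑ⇒↝ᶜ (sym e)         = ⊢ₑ⇒↜ᶜ e
  ⊢ₑ⇒↝ᶜ (trans e f)     = ↝ᶜ-trans (⊢ₑ⇒↝ᶜ e) (⊢ₑ⇒↝ᶜ f)
  ⊢ₑ⇒↝ᶜ (⋀-cong {b = b} {c} e f) =
    ↝ᶜ-trans (↝ᶜ-inContext (⊢ₑ⇒↝ᶜ e) (□ ⋀ₗ c)) (↝ᶜ-inContext (⊢ₑ⇒↝ᶜ f) (b ⋀ᵣ □))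
  ⊢ₑ⇒↝ᶜ (⋁-cong {b = b} {c} e f) =
    ↝ᶜ-trans (↝ᶜ-inContext (⊢ₑ⇒↝ᶜ e) (□ ⋁ₗ c)) (↝ᶜ-inContext (⊢ₑ⇒↝ᶜ f) (b ⋁ᵣ □))
  ⊢ₑ⇒↝ᶜ (∼-cong e)      = ↝ᶜ-inContext (⊢ₑ⇒↝ᶜ e) (∼ᶜ □)

  ⊢ₑ⇒↜ᶜ (axiom st∈L σ) = rewrite-↝ᶜ (basis-rewrite˘ st∈L) σ
  ⊢ₑ⇒↜ᶜ refl            = λ C z d → d
  ⊢ₑ⇒↜ᶜ (sym e)         = ⊢ₑ⇒↝ᶜ e
  ⊢ₑ⇒↜ᶜ (trans e f)     = ↝ᶜ-trans (⊢ₑ⇒↜ᶜ f) (⊢ₑ⇒↜ᶜ e)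
  ⊢ₑ⇒↜ᶜ (⋀-cong {b = b} {c} e f) =
    ↝ᶜ-trans (↝ᶜ-inContext (⊢ₑ⇒↜ᶜ f) (b ⋀ᵣ □)) (↝ᶜ-inContext (⊢ₑ⇒↜ᶜ e) (□ ⋀ₗ c))
  ⊢ₑ⇒↜ᶜ (⋁-cong {b = b} {c} e f) =
    ↝ᶜ-trans (↝ᶜ-inContext (⊢ₑ⇒↜ᶜ f) (b ⋁ᵣ □)) (↝ᶜ-inContext (⊢ₑ⇒↜ᶜ e) (□ ⋁ₗ c))
  ⊢ₑ⇒↜ᶜ (∼-cong e)      = ↝ᶜ-inContext (⊢ₑ⇒↜ᶜ e) (∼ᶜ □)

  ⊢ₑ⇒↝ : ∀ {a b} → L ⊢ₑ a ≈ b → a ↝ b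
  ⊢ₑ⇒↝ e = bwd x∨⊥ ▸ ⊢ₑ⇒↝ᶜ e □ ⊥f ▸ fwd x∨⊥

  derivable-isFilter : ∀ Γ → IsFilter (termAlgebra L) (Derivable rules Γ)
  derivable-isFilter Γ = record
    { nonempty = ⊤f , ⊤-derivable
    ; upward   = λ d a∧b≈a → ∧-elimʳ (⊢ₑ⇒↝ (sym a∧b≈a) d)
    ; meet     = ∧-intro
    }

  complete : ∀ {K} → K (termAlgebra L) → ∀ {Γ φ} → ⊢≤ K Γ φ → Derivable rules Γ φ
  complete K∋termAlgebra {Γ} {φ} Γ⊢φ =
    ≡.subst (Derivable rules Γ) (⟦⟧-termAlgebra-var L φ)
      (Γ⊢φ _ K∋termAlgebra (Derivable rules Γ) (derivable-isFilter Γ) var λ ψ ψ∈Γ →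
        ≡.subst (Derivable rules Γ) (≡.sym (⟦⟧-termAlgebra-var L ψ)) (assume ψ∈Γ))

  sound : ∀ {K} → (∀ A → K A → IsSDM A) → (∀ A → K A → ModL L A) →
          ∀ {Γ φ} → Derivable rules Γ φ → ⊢≤ K Γ φ
  sound K⊆SDM K⊨L d A KA F isF v Γ⊆F =
    derivable-sound A (K⊆SDM A KA) (rules-valid A (K⊆SDM A KA) (K⊨L A KA)) isF v Γ⊆F d

finitelyAxiomatizable : ∀ {E} → (∀ A → Mod E A → IsSDM A) →
                        FinitelyBasedVariety E → FinitelyAxiomatizableLogic (⊢≤ (Mod E))
finitelyAxiomatizable E⊆SDM (L , L⇔E) = rules , λ Γ φ →
  mk⇔ (complete (Equivalence.to (L⇔E (termAlgebra L)) (termAlgebra-⊨ L))) (sound E⊆SDM (Equivalence.from ∘ L⇔E))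
  where open FromBasis L

theorem4p7 : (E : Eqn → Set) → (∀ (A : Alg) → Mod E A → IsSDM A) →
    (FinitelyBasedVariety E ⇔ FinitelyAxiomatizableLogic (⊢≤ (Mod E)))
theorem4p7 E E⊆SDM = mk⇔ (finitelyAxiomatizable E⊆SDM) (finitelyBased E⊆SDM)
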